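{- Let $L$ be a locally finite modular lattice and let $S$ be a set of coverings of $L$ closed under cover-projectivity. Then the relation $\sim_S$ on $L$ is an equivalence relation.
   Context: Two coverings $x\lessdot y$ and $x'\lessdot y'$ are cover-projective if there are $a,b\in L$ with $a\vee b$ covering both $a$ and $b$, $a\wedge b$ covered by both, and $\{x\lessdot y, x'\lessdot y'\}$ equal to $\{a\wedge b\lessdot a,\ b\lessdot a\vee b\}$ or to $\{a\wedge b\lessdot b,\ a\lessdot a\vee b\}$; $S$ is closed under cover-projectivity if whenever a covering is in $S$ every covering cover-projective to it is in $S$. For $x,y\in L$, $x\sim_S y$ means that no covering in a maximal chain (path of successive coverings) from $x\wedge y$ to $x\vee y$ lies in $S$; for such $L$ and $S$ this does not depend on the chosen chain. -}

module Defs where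

open import Level using (Level; _⊔_)
open import Data.Product using (Σ; ∃; _×_; _,_)
open import Data.Sum using (_⊎_)
open import Data.List using (List)
open import Data.Unit.Polymorphic using (⊤)
open import Data.List.Relation.Unary.Any using (Any)
open import Relation.Nullary using (¬_)
open import Relation.Binary.Lattice.Bundles using (Lattice)

module LatticeNotions {c ℓ₁ ℓ₂ : Level} (L : Lattice c ℓ₁ ℓ₂) where
  open Lattice L

  IsModular : Set (c ⊔ ℓ₁ ⊔ ℓ₂)
  IsModular = ∀ x y z → x ≤ z → (x ∨ (y ∧ z)) ≈ ((x ∨ y) ∧ z)

  LocallyFinite : Set (c ⊔ ℓ₁ ⊔ ℓ₂)
  LocallyFinite = ∀ a b → ∃ λ (xs : List Carrier) →
                    ∀ z → a ≤ z → z ≤ b → Any (z ≈_) xs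

  _⋖_ : Carrier → Carrier → Set (c ⊔ ℓ₁ ⊔ ℓ₂)
  x ⋖ y = (x ≤ y) × (¬ (x ≈ y)) ×
          (∀ z → x ≤ z → z ≤ y → (z ≈ x) ⊎ (z ≈ y))

  IsCoveringSet : {s : Level} → (Carrier → Carrier → Set s) → Set (c ⊔ ℓ₁ ⊔ ℓ₂ ⊔ s)
  IsCoveringSet S =
    (∀ {x y} → S x y → x ⋖ y) ×
    (∀ {x y x' y'} → x ≈ x' → y ≈ y' → S x y → S x' y')

  SameCov : Carrier → Carrier → Carrier → Carrier → Set ℓ₁
  SameCov x y x' y' = (x ≈ x') × (y ≈ y')

  SamePair : Carrier → Carrier → Carrier → Carrier →
             Carrier → Carrier → Carrier → Carrier → Set ℓ₁
  SamePair x y x' y' p q p' q' =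
    (SameCov x y p q × SameCov x' y' p' q') ⊎
    (SameCov x y p' q' × SameCov x' y' p q)

  CoverProjective : Carrier → Carrier → Carrier → Carrier → Set (c ⊔ ℓ₁ ⊔ ℓ₂)
  CoverProjective x y x' y' =
    ∃ λ a → ∃ λ b →
      (a ⋖ (a ∨ b)) × (b ⋖ (a ∨ b)) × ((a ∧ b) ⋖ a) × ((a ∧ b) ⋖ b) ×
      (SamePair x y x' y' (a ∧ b) a b (a ∨ b) ⊎
       SamePair x y x' y' (a ∧ b) b a (a ∨ b))

  ClosedUnderCoverProjectivity : {s : Level} → (Carrier → Carrier → Set s) →
                                 Set (c ⊔ ℓ₁ ⊔ ℓ₂ ⊔ s)
  ClosedUnderCoverProjectivity S =
    ∀ {x y x' y'} → S x y → CoverProjective x y x' y' → S x' y'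

  data MaxChain : Carrier → Carrier → Set (c ⊔ ℓ₁ ⊔ ℓ₂) where
    done : ∀ {a b} → a ≈ b → MaxChain a b
    step : ∀ {a m b} → a ⋖ m → MaxChain m b → MaxChain a b

  AvoidsS : {s : Level} → (Carrier → Carrier → Set s) → ∀ {a b} →
            MaxChain a b → Set s
  AvoidsS S (done _) = ⊤
  AvoidsS S (step {a} {m} _ ch) = (¬ S a m) × AvoidsS S ch

  Sim : {s : Level} → (Carrier → Carrier → Set s) → Carrier → Carrier →
        Set (c ⊔ ℓ₁ ⊔ ℓ₂ ⊔ s)
  Sim S x y = Σ (MaxChain (x ∧ y) (x ∨ y)) (AvoidsS S)

module Submission where

-- In a modular lattice, joining (meeting) a maximal chain with a fixed element turns each
-- covering into an equality or a covering, and the diamond isomorphism theorem shows that a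
-- covering u ⋖ v is carried to t ⋖ t ∨ v (for u ≤ t) through a sequence of diamonds, i.e. of
-- cover-projectivities. Closure of S therefore lets S-free chains be pushed up and down. For
-- x ∼ y ∼ z one builds S-free chains from x and from z up to x ∨ y ∨ z and meets them down
-- to S-free chains from x and from z to x ∨ z; meeting the first with z gives an S-free chain
-- from x ∧ z to z, which the second continues to x ∨ z.

open import Defs
open import Level using (Level; _⊔_)
open import Function using (_∘_)
open import Data.Empty using (⊥-elim)
open import Data.Product using (Σ; _×_; _,_; proj₁)
open import Data.Sum using (_⊎_; inj₁; inj₂; map)
open import Relation.Nullary using (¬_)
open import Relation.Binary.Lattice.Bundles using (Lattice)
open import Relation.Binary.Structures using (IsEquivalence)
import Relation.Binary.Lattice.Properties.Lattice as LatticeProperties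
import Relation.Binary.Lattice.Properties.JoinSemilattice as JoinSemilatticeProperties
import Relation.Binary.Lattice.Properties.MeetSemilattice as MeetSemilatticeProperties
import Relation.Binary.Reasoning.Setoid as SetoidReasoning

module Coverings {c ℓ₁ ℓ₂ : Level} (L : Lattice c ℓ₁ ℓ₂) where
  open Lattice L public
  open LatticeNotions L public
  open LatticeProperties L public using (∨-absorbs-∧; collapse₁)
  open JoinSemilatticeProperties joinSemilattice public
    using (∨-comm; ∨-assoc; ∨-cong; ∨-monotonic; x≤y⇒x∨y≈y)
  open MeetSemilatticeProperties meetSemilattice public
    using (∧-comm; ∧-assoc; ∧-cong; ∧-monotonic; y≤x⇒x∧y≈y)

  private variable a a′ b b′ d u v w t p x y : Carrier

  x≤y⇒x∧y≈x : x ≤ y → x ∧ y ≈ x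
  x≤y⇒x∧y≈x x≤y = antisym (x∧y≤x _ _) (∧-greatest refl x≤y)

  y≤x⇒x∨y≈x : y ≤ x → x ∨ y ≈ x
  y≤x⇒x∨y≈x y≤x = antisym (∨-least refl y≤x) (x≤x∨y _ _)

  x≤y⇒[d∨x]∨y≈d∨y : x ≤ y → (d ∨ x) ∨ y ≈ d ∨ y
  x≤y⇒[d∨x]∨y≈d∨y {d = d} x≤y = Eq.trans (∨-assoc d _ _) (∨-cong Eq.refl (x≤y⇒x∨y≈y x≤y))

  x≤y⇒[d∧y]∧x≈d∧x : x ≤ y → (d ∧ y) ∧ x ≈ d ∧ x
  x≤y⇒[d∧y]∧x≈d∧x {d = d} x≤y = Eq.trans (∧-assoc d _ _) (∧-cong Eq.refl (y≤x⇒x∧y≈y x≤y))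

  ⋖⇒≤ : a ⋖ b → a ≤ b
  ⋖⇒≤ (a≤b , _) = a≤b

  ⋖⇒≉ : a ⋖ b → ¬ a ≈ b
  ⋖⇒≉ (_ , a≉b , _) = a≉b

  ⋖-between : a ⋖ b → a ≤ t → t ≤ b → t ≈ a ⊎ t ≈ b
  ⋖-between (_ , _ , between) = between _

  ⋖-resp : a ≈ a′ → b ≈ b′ → a ⋖ b → a′ ⋖ b′
  ⋖-resp a≈a′ b≈b′ (a≤b , a≉b , between) =
    trans (reflexive (Eq.sym a≈a′)) (trans a≤b (reflexive b≈b′)) ,
    (λ a′≈b′ → a≉b (Eq.trans a≈a′ (Eq.trans a′≈b′ (Eq.sym b≈b′)))) ,
    λ t a′≤t t≤b′ →
      map (λ t≈a → Eq.trans t≈a a≈a′) (λ t≈b → Eq.trans t≈b b≈b′)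
        (between t (trans (reflexive a≈a′) a′≤t) (trans t≤b′ (reflexive (Eq.sym b≈b′))))

  chain-resp : a ≈ a′ → b ≈ b′ → MaxChain a b → MaxChain a′ b′
  chain-resp a≈a′ b≈b′ (done a≈b) = done (Eq.trans (Eq.sym a≈a′) (Eq.trans a≈b b≈b′))
  chain-resp a≈a′ b≈b′ (step a⋖m ch) = step (⋖-resp a≈a′ Eq.refl a⋖m) (chain-resp Eq.refl b≈b′ ch)

  chain⇒≤ : MaxChain a b → a ≤ b
  chain⇒≤ (done a≈b) = reflexive a≈b
  chain⇒≤ (step a⋖m ch) = trans (⋖⇒≤ a⋖m) (chain⇒≤ ch)

  two-upper-covers : u ⋖ v → u ⋖ w → v ≈ w ⊎ v ∧ w ≈ u
  two-upper-covers u⋖v u⋖w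
    with ⋖-between u⋖w (∧-greatest (⋖⇒≤ u⋖v) (⋖⇒≤ u⋖w)) (x∧y≤y _ _)
  ... | inj₁ v∧w≈u = inj₂ v∧w≈u
  ... | inj₂ v∧w≈w with ⋖-between u⋖v (⋖⇒≤ u⋖w) (trans (reflexive (Eq.sym v∧w≈w)) (x∧y≤x _ _))
  ...   | inj₁ w≈u = ⊥-elim (⋖⇒≉ u⋖w (Eq.sym w≈u))
  ...   | inj₂ w≈v = inj₁ (Eq.sym w≈v)

  two-lower-covers : t ⋖ w → p ⋖ w → t ≈ p ⊎ t ∨ p ≈ w
  two-lower-covers t⋖w p⋖w
    with ⋖-between p⋖w (y≤x∨y _ _) (∨-least (⋖⇒≤ t⋖w) (⋖⇒≤ p⋖w))
  ... | inj₂ t∨p≈w = inj₂ t∨p≈w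
  ... | inj₁ t∨p≈p with ⋖-between t⋖w (trans (x≤x∨y _ _) (reflexive t∨p≈p)) (⋖⇒≤ p⋖w)
  ...   | inj₁ p≈t = inj₁ (Eq.sym p≈t)
  ...   | inj₂ p≈w = ⊥-elim (⋖⇒≉ p⋖w p≈w)

  record Diamond (a b : Carrier) : Set (c ⊔ ℓ₁ ⊔ ℓ₂) where
    field
      a⋖a∨b : a ⋖ (a ∨ b)
      b⋖a∨b : b ⋖ (a ∨ b)
      a∧b⋖a : (a ∧ b) ⋖ a
      a∧b⋖b : (a ∧ b) ⋖ b

module Modular {c ℓ₁ ℓ₂ : Level} (L : Lattice c ℓ₁ ℓ₂) (modular : LatticeNotions.IsModular L) where
  open Coverings L
  open SetoidReasoning setoid

  private variable a b s t u v : Carrier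

  a≤t≤a∨b⇒a∨[b∧t]≈t : a ≤ t → t ≤ a ∨ b → a ∨ (b ∧ t) ≈ t
  a≤t≤a∨b⇒a∨[b∧t]≈t {a} {t} {b} a≤t t≤a∨b = Eq.trans (modular a b t a≤t) (y≤x⇒x∧y≈y t≤a∨b)

  a∧b≤s≤b⇒[s∨a]∧b≈s : a ∧ b ≤ s → s ≤ b → (s ∨ a) ∧ b ≈ s
  a∧b≤s≤b⇒[s∨a]∧b≈s {a} {b} {s} a∧b≤s s≤b =
    Eq.trans (Eq.sym (modular s a b s≤b)) (y≤x⇒x∨y≈x a∧b≤s)

  transpose-up : (a ∧ b) ⋖ b → a ⋖ (a ∨ b)
  transpose-up {a} {b} a∧b⋖b = x≤x∨y a b , a≉a∨b , between
    where
    a≉a∨b : ¬ a ≈ a ∨ b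
    a≉a∨b a≈a∨b = ⋖⇒≉ a∧b⋖b (y≤x⇒x∧y≈y (trans (y≤x∨y a b) (reflexive (Eq.sym a≈a∨b))))

    between : ∀ t → a ≤ t → t ≤ a ∨ b → t ≈ a ⊎ t ≈ a ∨ b
    between t a≤t t≤a∨b
      with ⋖-between a∧b⋖b (∧-greatest (x∧y≤y a b) (trans (x∧y≤x a b) a≤t)) (x∧y≤x b t)
    ... | inj₁ b∧t≈a∧b = inj₁ (begin
      t           ≈⟨ a≤t≤a∨b⇒a∨[b∧t]≈t a≤t t≤a∨b ⟨
      a ∨ (b ∧ t) ≈⟨ ∨-cong Eq.refl b∧t≈a∧b ⟩
      a ∨ (a ∧ b) ≈⟨ ∨-absorbs-∧ a b ⟩
      a           ∎)
    ... | inj₂ b∧t≈b = inj₂ (begin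
      t           ≈⟨ a≤t≤a∨b⇒a∨[b∧t]≈t a≤t t≤a∨b ⟨
      a ∨ (b ∧ t) ≈⟨ ∨-cong Eq.refl b∧t≈b ⟩
      a ∨ b       ∎)

  transpose-down : a ⋖ (a ∨ b) → (a ∧ b) ⋖ b
  transpose-down {a} {b} a⋖a∨b = x∧y≤y a b , a∧b≉b , between
    where
    a∧b≉b : ¬ a ∧ b ≈ b
    a∧b≉b a∧b≈b = ⋖⇒≉ a⋖a∨b (Eq.sym (y≤x⇒x∨y≈x (trans (reflexive (Eq.sym a∧b≈b)) (x∧y≤x a b))))

    between : ∀ s → a ∧ b ≤ s → s ≤ b → s ≈ a ∧ b ⊎ s ≈ b
    between s a∧b≤s s≤b
      with ⋖-between a⋖a∨b (y≤x∨y s a) (∨-least (trans s≤b (y≤x∨y a b)) (x≤x∨y a b))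
    ... | inj₁ s∨a≈a = inj₁ (begin
      s           ≈⟨ a∧b≤s≤b⇒[s∨a]∧b≈s a∧b≤s s≤b ⟨
      (s ∨ a) ∧ b ≈⟨ ∧-cong s∨a≈a Eq.refl ⟩
      a ∧ b       ∎)
    ... | inj₂ s∨a≈a∨b = inj₂ (begin
      s           ≈⟨ a∧b≤s≤b⇒[s∨a]∧b≈s a∧b≤s s≤b ⟨
      (s ∨ a) ∧ b ≈⟨ ∧-cong s∨a≈a∨b Eq.refl ⟩
      (a ∨ b) ∧ b ≈⟨ y≤x⇒x∧y≈y (y≤x∨y a b) ⟩
      b           ∎)

  join-covering : u ⋖ v → ∀ d → u ∨ d ≈ v ∨ d ⊎ (u ∨ d) ⋖ (v ∨ d)
  join-covering {u} {v} u⋖v d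
    with ⋖-between u⋖v (∧-greatest (x≤x∨y u d) (⋖⇒≤ u⋖v)) (x∧y≤y (u ∨ d) v)
  ... | inj₁ [u∨d]∧v≈u =
    inj₂ (⋖-resp Eq.refl [u∨d]∨v≈v∨d (transpose-up (⋖-resp (Eq.sym [u∨d]∧v≈u) Eq.refl u⋖v)))
    where
    [u∨d]∨v≈v∨d : (u ∨ d) ∨ v ≈ v ∨ d
    [u∨d]∨v≈v∨d = antisym (∨-least (∨-monotonic (⋖⇒≤ u⋖v) refl) (x≤x∨y v d))
                          (∨-least (y≤x∨y _ v) (trans (y≤x∨y u d) (x≤x∨y _ v)))
  ... | inj₂ [u∨d]∧v≈v =
    inj₁ (antisym (∨-monotonic (⋖⇒≤ u⋖v) refl)
                  (∨-least (trans (reflexive (Eq.sym [u∨d]∧v≈v)) (x∧y≤x _ v)) (y≤x∨y u d)))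

  meet-covering : u ⋖ v → ∀ d → u ∧ d ≈ v ∧ d ⊎ (u ∧ d) ⋖ (v ∧ d)
  meet-covering {u} {v} u⋖v d
    with ⋖-between u⋖v (x≤x∨y u (v ∧ d)) (∨-least (⋖⇒≤ u⋖v) (x∧y≤x v d))
  ... | inj₁ u∨[v∧d]≈u =
    inj₁ (antisym (∧-monotonic (⋖⇒≤ u⋖v) refl)
                  (∧-greatest (trans (y≤x∨y u _) (reflexive u∨[v∧d]≈u)) (x∧y≤y v d)))
  ... | inj₂ u∨[v∧d]≈v =
    inj₂ (⋖-resp u∧[v∧d]≈u∧d Eq.refl (transpose-down (⋖-resp Eq.refl (Eq.sym u∨[v∧d]≈v) u⋖v)))
    where
    u∧[v∧d]≈u∧d : u ∧ (v ∧ d) ≈ u ∧ d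
    u∧[v∧d]≈u∧d = Eq.trans (Eq.sym (∧-assoc u v d)) (∧-cong (x≤y⇒x∧y≈x (⋖⇒≤ u⋖v)) Eq.refl)

  chain-join : MaxChain u v → ∀ d → MaxChain (u ∨ d) (v ∨ d)
  chain-join (done u≈v) d = done (∨-cong u≈v Eq.refl)
  chain-join (step u⋖m ch) d with join-covering u⋖m d
  ... | inj₁ u∨d≈m∨d = chain-resp (Eq.sym u∨d≈m∨d) Eq.refl (chain-join ch d)
  ... | inj₂ u∨d⋖m∨d = step u∨d⋖m∨d (chain-join ch d)

  chain-meet : MaxChain u v → ∀ d → MaxChain (u ∧ d) (v ∧ d)
  chain-meet (done u≈v) d = done (∧-cong u≈v Eq.refl)
  chain-meet (step u⋖m ch) d with meet-covering u⋖m d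
  ... | inj₁ u∧d≈m∧d = chain-resp (Eq.sym u∧d≈m∧d) Eq.refl (chain-meet ch d)
  ... | inj₂ u∧d⋖m∧d = step u∧d⋖m∧d (chain-meet ch d)

  diamond-from-below : (a ∧ b) ⋖ a → (a ∧ b) ⋖ b → Diamond a b
  diamond-from-below {a} {b} a∧b⋖a a∧b⋖b = record
    { a⋖a∨b = transpose-up a∧b⋖b
    ; b⋖a∨b = ⋖-resp Eq.refl (∨-comm b a) (transpose-up (⋖-resp (∧-comm a b) Eq.refl a∧b⋖a))
    ; a∧b⋖a = a∧b⋖a
    ; a∧b⋖b = a∧b⋖b
    }

  diamond-from-above : a ⋖ (a ∨ b) → b ⋖ (a ∨ b) → Diamond a b
  diamond-from-above {a} {b} a⋖a∨b b⋖a∨b = record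
    { a⋖a∨b = a⋖a∨b
    ; b⋖a∨b = b⋖a∨b
    ; a∧b⋖a = ⋖-resp (∧-comm b a) Eq.refl (transpose-down (⋖-resp Eq.refl (∨-comm a b) b⋖a∨b))
    ; a∧b⋖b = transpose-down a⋖a∨b
    }

module FreeChains {c ℓ₁ ℓ₂ s : Level} (L : Lattice c ℓ₁ ℓ₂)
  (modular : LatticeNotions.IsModular L)
  (S : Lattice.Carrier L → Lattice.Carrier L → Set s)
  (S-resp : ∀ {x y x′ y′} → Lattice._≈_ L x x′ → Lattice._≈_ L y y′ → S x y → S x′ y′)
  (closed : LatticeNotions.ClosedUnderCoverProjectivity L S) where
  open Coverings L
  open Modular L modular
  open Diamond

  private variable a a′ b b′ d u v w t x y z : Carrier

  FreeChain : Carrier → Carrier → Set (c ⊔ ℓ₁ ⊔ ℓ₂ ⊔ s)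
  FreeChain a b = Σ (MaxChain a b) (AvoidsS S)

  FreeStep : Carrier → Carrier → Set (c ⊔ ℓ₁ ⊔ ℓ₂ ⊔ s)
  FreeStep a b = a ≈ b ⊎ (a ⋖ b × ¬ S a b)

  ¬S-resp : a ≈ a′ → b ≈ b′ → ¬ S a b → ¬ S a′ b′
  ¬S-resp a≈a′ b≈b′ ¬Sab = ¬Sab ∘ S-resp (Eq.sym a≈a′) (Eq.sym b≈b′)

  free-resp : a ≈ a′ → b ≈ b′ → FreeChain a b → FreeChain a′ b′
  free-resp a≈a′ b≈b′ (done a≈b , _) = done (Eq.trans (Eq.sym a≈a′) (Eq.trans a≈b b≈b′)) , _
  free-resp a≈a′ b≈b′ (step a⋖m ch , ¬Sam , avoids) with free-resp Eq.refl b≈b′ (ch , avoids)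
  ... | ch′ , avoids′ = step (⋖-resp a≈a′ Eq.refl a⋖m) ch′ , ¬S-resp a≈a′ Eq.refl ¬Sam , avoids′

  free-++ : FreeChain a b → FreeChain b d → FreeChain a d
  free-++ (done a≈b , _) F = free-resp (Eq.sym a≈b) Eq.refl F
  free-++ (step a⋖m ch , ¬Sam , avoids) F with free-++ (ch , avoids) F
  ... | ch′ , avoids′ = step a⋖m ch′ , ¬Sam , avoids′

  freeStep⇒freeChain : FreeStep a b → FreeChain a b
  freeStep⇒freeChain (inj₁ a≈b) = done a≈b , _
  freeStep⇒freeChain (inj₂ (a⋖b , ¬Sab)) = step a⋖b (done Eq.refl) , ¬Sab , _

  freeStep-resp : a ≈ a′ → b ≈ b′ → FreeStep a b → FreeStep a′ b′
  freeStep-resp a≈a′ b≈b′ (inj₁ a≈b) = inj₁ (Eq.trans (Eq.sym a≈a′) (Eq.trans a≈b b≈b′))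
  freeStep-resp a≈a′ b≈b′ (inj₂ (a⋖b , ¬Sab)) = inj₂ (⋖-resp a≈a′ b≈b′ a⋖b , ¬S-resp a≈a′ b≈b′ ¬Sab)

  S-transfer↓ : Diamond a b → S a (a ∨ b) → S (a ∧ b) b
  S-transfer↓ {a} {b} D Sa = closed Sa
    (a , b , a⋖a∨b D , b⋖a∨b D , a∧b⋖a D , a∧b⋖b D ,
     inj₂ (inj₂ ((Eq.refl , Eq.refl) , (Eq.refl , Eq.refl))))

  S-transfer↑ : Diamond a b → S (a ∧ b) a → S b (a ∨ b)
  S-transfer↑ {a} {b} D Sa∧b = closed Sa∧b
    (a , b , a⋖a∨b D , b⋖a∨b D , a∧b⋖a D , a∧b⋖b D ,
     inj₁ (inj₁ ((Eq.refl , Eq.refl) , (Eq.refl , Eq.refl))))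

  cover-join-free : u ⋖ v → ¬ S u v → MaxChain u t → FreeStep t (t ∨ v)
  cover-join-free u⋖v ¬Suv (done u≈t) =
    freeStep-resp u≈t (Eq.sym (x≤y⇒x∨y≈y (trans (reflexive (Eq.sym u≈t)) (⋖⇒≤ u⋖v))))
      (inj₂ (u⋖v , ¬Suv))
  cover-join-free {v = v} {t = t} u⋖v ¬Suv (step {m = w} u⋖w ch) with two-upper-covers u⋖w u⋖v
  ... | inj₁ w≈v = inj₁ (Eq.sym (y≤x⇒x∨y≈x (trans (reflexive (Eq.sym w≈v)) (chain⇒≤ ch))))
  ... | inj₂ w∧v≈u = freeStep-resp Eq.refl t∨[w∨v]≈t∨v (cover-join-free (a⋖a∨b D) ¬Sw[w∨v] ch)
    where
    D : Diamond w v
    D = diamond-from-below (⋖-resp (Eq.sym w∧v≈u) Eq.refl u⋖w) (⋖-resp (Eq.sym w∧v≈u) Eq.refl u⋖v)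

    ¬Sw[w∨v] : ¬ S w (w ∨ v)
    ¬Sw[w∨v] = ¬S-resp (Eq.sym w∧v≈u) Eq.refl ¬Suv ∘ S-transfer↓ D

    t∨[w∨v]≈t∨v : t ∨ (w ∨ v) ≈ t ∨ v
    t∨[w∨v]≈t∨v = Eq.trans (Eq.sym (∨-assoc t w v)) (∨-cong (y≤x⇒x∨y≈x (chain⇒≤ ch)) Eq.refl)

  cover-meet-free : u ⋖ v → ¬ S u v → MaxChain t v → FreeStep (t ∧ u) t
  cover-meet-free u⋖v ¬Suv (done t≈v) =
    freeStep-resp (Eq.sym (y≤x⇒x∧y≈y (trans (⋖⇒≤ u⋖v) (reflexive (Eq.sym t≈v))))) (Eq.sym t≈v)
      (inj₂ (u⋖v , ¬Suv))
  cover-meet-free {u = u} {t = t} u⋖v ¬Suv (step {m = t₁} t⋖t₁ ch) with cover-meet-free u⋖v ¬Suv ch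
  ... | inj₁ t₁∧u≈t₁ =
    inj₁ (x≤y⇒x∧y≈x (trans (⋖⇒≤ t⋖t₁) (trans (reflexive (Eq.sym t₁∧u≈t₁)) (x∧y≤y t₁ u))))
  ... | inj₂ (p⋖t₁ , ¬Spt₁) with two-lower-covers t⋖t₁ p⋖t₁
  ...   | inj₁ t≈p = inj₁ (x≤y⇒x∧y≈x (trans (reflexive t≈p) (x∧y≤y t₁ u)))
  ...   | inj₂ t∨p≈t₁ = freeStep-resp t∧p≈t∧u Eq.refl (inj₂ (a∧b⋖a D , ¬St∧p))
    where
    D : Diamond t (t₁ ∧ u)
    D = diamond-from-above (⋖-resp Eq.refl (Eq.sym t∨p≈t₁) t⋖t₁) (⋖-resp Eq.refl (Eq.sym t∨p≈t₁) p⋖t₁)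

    ¬St∧p : ¬ S (t ∧ (t₁ ∧ u)) t
    ¬St∧p = ¬S-resp Eq.refl (Eq.sym t∨p≈t₁) ¬Spt₁ ∘ S-transfer↑ D

    t∧p≈t∧u : t ∧ (t₁ ∧ u) ≈ t ∧ u
    t∧p≈t∧u = Eq.trans (Eq.sym (∧-assoc t t₁ u)) (∧-cong (x≤y⇒x∧y≈x (⋖⇒≤ t⋖t₁)) Eq.refl)

  free-join : FreeChain u v → MaxChain u (d ∨ u) → FreeChain (d ∨ u) (d ∨ v)
  free-join (done u≈v , _) _ = done (∨-cong Eq.refl u≈v) , _
  free-join {u = u} {d = d} (step {m = u₁} u⋖u₁ ch , ¬Suu₁ , avoids) C =
    free-++ (freeStep⇒freeChain first) (free-join (ch , avoids) C₁)
    where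
    [d∨u]∨u₁≈d∨u₁ : (d ∨ u) ∨ u₁ ≈ d ∨ u₁
    [d∨u]∨u₁≈d∨u₁ = x≤y⇒[d∨x]∨y≈d∨y (⋖⇒≤ u⋖u₁)

    first : FreeStep (d ∨ u) (d ∨ u₁)
    first = freeStep-resp Eq.refl [d∨u]∨u₁≈d∨u₁ (cover-join-free u⋖u₁ ¬Suu₁ C)

    C₁ : MaxChain u₁ (d ∨ u₁)
    C₁ = chain-resp (x≤y⇒x∨y≈y (⋖⇒≤ u⋖u₁)) [d∨u]∨u₁≈d∨u₁ (chain-join C u₁)

  free-meet : FreeChain u v → MaxChain (d ∧ v) v → FreeChain (d ∧ u) (d ∧ v)
  free-meet (done u≈v , _) _ = done (∧-cong Eq.refl u≈v) , _
  free-meet {u = u} {d = d} (step {m = u₁} u⋖u₁ ch , ¬Suu₁ , avoids) C =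
    free-++ (freeStep⇒freeChain first) (free-meet (ch , avoids) C)
    where
    C₁ : MaxChain (d ∧ u₁) u₁
    C₁ = chain-resp (x≤y⇒[d∧y]∧x≈d∧x (chain⇒≤ ch)) (y≤x⇒x∧y≈y (chain⇒≤ ch)) (chain-meet C u₁)

    first : FreeStep (d ∧ u) (d ∧ u₁)
    first = freeStep-resp (x≤y⇒[d∧y]∧x≈d∧x (⋖⇒≤ u⋖u₁)) Eq.refl (cover-meet-free u⋖u₁ ¬Suu₁ C₁)

  sim-refl : Sim S x x
  sim-refl = done (collapse₁ Eq.refl) , _

  sim-sym : Sim S x y → Sim S y x
  sim-sym {x} {y} = free-resp (∧-comm x y) (∨-comm x y)

  sim⇒free-to-join : Sim S x y → FreeChain x (x ∨ y)
  sim⇒free-to-join {x} {y} x∼y = free-resp (∨-absorbs-∧ x y) (x≤y⇒x∨y≈y (x≤x∨y x y)) (free-join x∼y C)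
    where
    C : MaxChain (x ∧ y) (x ∨ (x ∧ y))
    C = chain-resp (x≤y⇒x∧y≈x (x∧y≤x x y))
                   (Eq.trans (y≤x⇒x∧y≈y (x≤x∨y x y)) (Eq.sym (∨-absorbs-∧ x y)))
                   (chain-meet (proj₁ x∼y) x)

  sim-sim⇒free-to-join : Sim S x y → Sim S y z → FreeChain x (x ∨ (y ∨ z))
  sim-sim⇒free-to-join {x} {y} x∼y y∼z =
    free-++ (sim⇒free-to-join x∼y) (free-join (sim⇒free-to-join y∼z) y→x∨y)
    where
    y→x∨y : MaxChain y (x ∨ y)
    y→x∨y = chain-resp Eq.refl (∨-comm y x) (proj₁ (sim⇒free-to-join (sim-sym x∼y)))

  free-cut-to-join : FreeChain x w → FreeChain z w → FreeChain x (x ∨ z)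
  free-cut-to-join {x} {w} {z} Fx Fz =
    free-resp (y≤x⇒x∧y≈y (x≤x∨y x z)) (x≤y⇒x∧y≈x x∨z≤w) (free-meet {d = x ∨ z} Fx C)
    where
    x∨z≤w : x ∨ z ≤ w
    x∨z≤w = ∨-least (chain⇒≤ (proj₁ Fx)) (chain⇒≤ (proj₁ Fz))

    C : MaxChain ((x ∨ z) ∧ w) w
    C = chain-resp (Eq.trans (∨-comm z x) (Eq.sym (x≤y⇒x∧y≈x x∨z≤w)))
                   (y≤x⇒x∨y≈x (chain⇒≤ (proj₁ Fx)))
                   (chain-join (proj₁ Fz) x)

  free-to-join⇒sim : FreeChain x (x ∨ z) → FreeChain z (x ∨ z) → Sim S x z
  free-to-join⇒sim {x} {z} Fx Fz =
    free-resp (∧-comm z x) Eq.refl (free-++ (free-resp Eq.refl z∧[x∨z]≈z (free-meet {d = z} Fx C)) Fz)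
    where
    z∧[x∨z]≈z : z ∧ (x ∨ z) ≈ z
    z∧[x∨z]≈z = x≤y⇒x∧y≈x (y≤x∨y x z)

    C : MaxChain (z ∧ (x ∨ z)) (x ∨ z)
    C = chain-resp (Eq.sym z∧[x∨z]≈z) Eq.refl (proj₁ Fz)

  sim-trans : Sim S x y → Sim S y z → Sim S x z
  sim-trans {x} {y} {z} x∼y y∼z =
    free-to-join⇒sim (free-cut-to-join Fx Fz) (free-resp Eq.refl (∨-comm z x) (free-cut-to-join Fz Fx))
    where
    z∨[y∨x]≈x∨[y∨z] : z ∨ (y ∨ x) ≈ x ∨ (y ∨ z)
    z∨[y∨x]≈x∨[y∨z] = antisym
      (∨-least (trans (y≤x∨y y z) (y≤x∨y x _)) (∨-least (trans (x≤x∨y y z) (y≤x∨y x _)) (x≤x∨y x _)))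
      (∨-least (trans (y≤x∨y y x) (y≤x∨y z _)) (∨-least (trans (x≤x∨y y x) (y≤x∨y z _)) (x≤x∨y z _)))

    Fx : FreeChain x (x ∨ (y ∨ z))
    Fx = sim-sim⇒free-to-join x∼y y∼z

    Fz : FreeChain z (x ∨ (y ∨ z))
    Fz = free-resp Eq.refl z∨[y∨x]≈x∨[y∨z] (sim-sim⇒free-to-join (sim-sym y∼z) (sim-sym x∼y))

  sim-isEquivalence : IsEquivalence (Sim S)
  sim-isEquivalence = record { refl = sim-refl ; sym = sim-sym ; trans = sim-trans }

lemma4p10 : ∀ {c ℓ₁ ℓ₂ s : Level} (L : Lattice c ℓ₁ ℓ₂) →
    LatticeNotions.IsModular L → LatticeNotions.LocallyFinite L →
    (S : Lattice.Carrier L → Lattice.Carrier L → Set s) →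
    LatticeNotions.IsCoveringSet L S →
    LatticeNotions.ClosedUnderCoverProjectivity L S →
    IsEquivalence (LatticeNotions.Sim L S)
lemma4p10 L modular _ S (_ , S-resp) closed = sim-isEquivalence
  where open FreeChains L modular S S-resp closed
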